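{- Let $H$ be a partially oriented graph whose underlying graph $U(H)$ is local tournament orientable. Then $H$ can be completed to a local tournament if and only if $H$ does not contain opposing arcs, i.e., there are no arcs $(a,b),(c,d)$ of $H$ with $(a,b)\Gamma^*(d,c)$ in $Z(U(H))$.
   Context: A partially oriented graph $H=(V,E\cup A)$ is obtained from a simple graph $G$ (its underlying graph $U(H)=G$) by orienting some of its edges; $E$ = unoriented edges, $A$ = arcs $(u,v)$. A local tournament is an oriented graph (no loops, at most one arc between two vertices) in which the in- and out-neighbourhood of every vertex each induce a tournament; a graph is local tournament orientable if it has such an orientation. $H$ can be completed to a local tournament if its unoriented edges can be oriented so the result is a local tournament. For a graph $G$, $Z(G)=\{(u,v): uv\in E(G)\}$; $(u,v)\Gamma(x,y)$ means: $u=x,v=y$; or $u=y$, $v\ne x$, $vx\notin E(G)$; or $v=x$, $u\ne y$, $uy\notin E(G)$; and $\Gamma^*$ is the relation given by finite chains of $\Gamma$ within $Z(G)$. -}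

module Defs where

open import Data.Nat using (ℕ)
open import Data.Fin using (Fin)
open import Data.Bool using (Bool; true; false; T)
open import Data.Product using (Σ; ∃; _×_; _,_)
open import Data.Sum using (_⊎_)
open import Relation.Nullary using (¬_)
open import Relation.Binary.PropositionalEquality using (_≡_; _≢_)
open import Relation.Binary.Construct.Closure.Transitive using (TransClosure)

record Graph (n : ℕ) : Set where
  field
    adj   : Fin n → Fin n → Bool
    irrefl : ∀ u → adj u u ≡ false
    sym   : ∀ u v → adj u v ≡ adj v u
open Graph public

-- A partially oriented graph H = (V, E ∪ A): its underlying graph together
-- with the set of arcs A.  Every arc (u,v) lies on an edge uv, and at most
-- one direction of an edge is an arc; the remaining edges form E.
record POGraph (n : ℕ) : Set where
  field
    U     : Graph n
    arc   : Fin n → Fin n → Bool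
    arc⊆  : ∀ u v → T (arc u v) → T (adj U u v)
    arcAnti : ∀ u v → T (arc u v) → ¬ T (arc v u)
open POGraph public

record IsOrientation {n : ℕ} (G : Graph n) (D : Fin n → Fin n → Bool) : Set where
  field
    onEdges : ∀ u v → T (D u v) → T (adj G u v)
    total   : ∀ u v → T (adj G u v) → T (D u v) ⊎ T (D v u)
    anti    : ∀ u v → T (D u v) → ¬ T (D v u)
open IsOrientation public

IsLocalTournament : ∀ {n} → (Fin n → Fin n → Bool) → Set
IsLocalTournament {n} D =
  (∀ x y z → T (D x y) → T (D x z) → y ≢ z → T (D y z) ⊎ T (D z y)) ×
  (∀ x y z → T (D y x) → T (D z x) → y ≢ z → T (D y z) ⊎ T (D z y))

LTOrientable : ∀ {n} → Graph n → Set
LTOrientable {n} G =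
  Σ (Fin n → Fin n → Bool) λ D → IsOrientation G D × IsLocalTournament D

CompletableToLT : ∀ {n} → POGraph n → Set
CompletableToLT {n} H =
  Σ (Fin n → Fin n → Bool) λ D →
    IsOrientation (U H) D × IsLocalTournament D ×
    (∀ u v → T (arc H u v) → T (D u v))

InZ : ∀ {n} → Graph n → Fin n × Fin n → Set
InZ G (u , v) = T (adj G u v)

Γ : ∀ {n} → Graph n → Fin n × Fin n → Fin n × Fin n → Set
Γ G (u , v) (x , y) =
  InZ G (u , v) × InZ G (x , y) ×
  ( (u ≡ x × v ≡ y)
  ⊎ (u ≡ y × v ≢ x × ¬ T (adj G v x))
  ⊎ (v ≡ x × u ≢ y × ¬ T (adj G u y)) )

-- Γ* : finite chains of Γ within Z(G).  Since Γ is reflexive on Z(G), the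
-- transitive closure equals the reflexive-transitive closure on Z(G).
Γ* : ∀ {n} → Graph n → Fin n × Fin n → Fin n × Fin n → Set
Γ* G = TransClosure (Γ G)

HasOpposingArcs : ∀ {n} → POGraph n → Set
HasOpposingArcs {n} H =
  Σ (Fin n) λ a → Σ (Fin n) λ b → Σ (Fin n) λ c → Σ (Fin n) λ d →
    T (arc H a b) × T (arc H c d) × Γ* (U H) (a , b) (d , c)

-- An orientation of U(H) is a local tournament exactly when its arc set is
-- closed under Γ.  Hence every completion of H contains each pair that is
-- Γ*-reachable from an arc of H, and opposing arcs would force both
-- directions of one edge.  Conversely, without opposing arcs these forced
-- pairs never conflict, so orienting them as forced and every other edge as
-- in a given local-tournament orientation of U(H) is again Γ-closed, hence a
-- local tournament completing H.
module Submission where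

open import Defs
open import Data.Nat using (ℕ)
open import Data.Fin using (Fin; _≟_)
open import Data.Fin.Properties using (any?)
open import Data.Bool using (Bool; true; false; T)
open import Data.Unit using (tt)
open import Data.Product using (∃; _×_; _,_; swap)
open import Data.Sum using (_⊎_; inj₁; inj₂)
import Data.Sum as ⊎
open import Data.Empty using (⊥-elim)
open import Data.List using (List; []; _∷_; allFin; cartesianProduct)
open import Data.List.Membership.Propositional using (_∈_)
open import Data.List.Membership.Propositional.Properties using (∈-allFin; ∈-cartesianProduct⁺)
open import Data.List.Relation.Unary.Any using (here; there)
open import Function.Base using (_∘_)
open import Function.Bundles using (_⇔_; mk⇔)
open import Level using (0ℓ)
open import Relation.Binary.Core using (Rel)
open import Relation.Binary.Definitions using (Decidable)
open import Relation.Nullary using (¬_; Dec; yes; no)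
open import Relation.Nullary.Decidable using (_×-dec_; _⊎-dec_; ¬?; map′; T?)
open import Relation.Binary.PropositionalEquality using (_≢_; refl; subst; ≢-sym)
open import Relation.Binary.Construct.Closure.Transitive
  using (TransClosure; [_]; _∷_; _∷ʳ_; _++_; symmetric)

-- R-chains whose intermediate points lie in S; recursion on S decides them
-- (Floyd–Warshall), and for S enumerating X they are the transitive closure.
data Via {X : Set} (R : Rel X 0ℓ) (S : List X) : Rel X 0ℓ where
  [_]    : ∀ {x y} → R x y → Via R S x y
  _∷⟨_⟩_ : ∀ {x z y} → R x z → z ∈ S → Via R S z y → Via R S x y

module _ {X : Set} {R : Rel X 0ℓ} where

  via-weaken : ∀ {S v x y} → Via R S x y → Via R (v ∷ S) x y
  via-weaken [ r ]          = [ r ]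
  via-weaken (r ∷⟨ z∈ ⟩ rs) = r ∷⟨ there z∈ ⟩ via-weaken rs

  via-join : ∀ {S x v y} → Via R S x v → v ∈ S → Via R S v y → Via R S x y
  via-join [ r ]          v∈ rs′ = r ∷⟨ v∈ ⟩ rs′
  via-join (r ∷⟨ z∈ ⟩ rs) v∈ rs′ = r ∷⟨ z∈ ⟩ via-join rs v∈ rs′

  via-split : ∀ {S v x y} → Via R (v ∷ S) x y →
              Via R S x y ⊎ (Via R S x v × Via R S v y)
  via-split [ r ] = inj₁ [ r ]
  via-split (r ∷⟨ here refl ⟩ rs) with via-split rs
  ... | inj₁ rs′       = inj₂ ([ r ] , rs′)
  ... | inj₂ (_ , rs′) = inj₂ ([ r ] , rs′)
  via-split (r ∷⟨ there z∈ ⟩ rs) with via-split rs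
  ... | inj₁ rs′         = inj₁ (r ∷⟨ z∈ ⟩ rs′)
  ... | inj₂ (rs′ , rs″) = inj₂ (r ∷⟨ z∈ ⟩ rs′ , rs″)

  via? : Decidable R → ∀ S → Decidable (Via R S)
  via? R? [] x y with R? x y
  ... | yes r = yes [ r ]
  ... | no ¬r = no λ { [ r ] → ¬r r ; (_ ∷⟨ () ⟩ _) }
  via? R? (v ∷ S) x y with via? R? S x y | via? R? S x v | via? R? S v y
  ... | yes xy | _      | _      = yes (via-weaken xy)
  ... | no ¬xy | yes xv | yes vy = yes (via-join (via-weaken xv) (here refl) (via-weaken vy))
  ... | no ¬xy | yes _  | no ¬vy = no λ p → ⊎.[ ¬xy , (λ (_ , vy) → ¬vy vy) ] (via-split p)
  ... | no ¬xy | no ¬xv | _      = no λ p → ⊎.[ ¬xy , (λ (xv , _) → ¬xv xv) ] (via-split p)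

  via⇒⁺ : ∀ {S x y} → Via R S x y → TransClosure R x y
  via⇒⁺ [ r ]         = [ r ]
  via⇒⁺ (r ∷⟨ _ ⟩ rs) = r ∷ via⇒⁺ rs

  ⁺⇒via : ∀ {S} → (∀ z → z ∈ S) → ∀ {x y} → TransClosure R x y → Via R S x y
  ⁺⇒via enum [ r ]                = [ r ]
  ⁺⇒via enum (_∷_ {y = z} r rs) = r ∷⟨ enum z ⟩ ⁺⇒via enum rs

  transClosure? : Decidable R → (S : List X) → (∀ z → z ∈ S) →
                  Decidable (TransClosure R)
  transClosure? R? S enum x y = map′ via⇒⁺ (⁺⇒via enum) (via? R? S x y)

module _ {n : ℕ} (G : Graph n) where

  adj-sym : ∀ {u v} → T (adj G u v) → T (adj G v u)
  adj-sym {u} {v} = subst T (sym G u v)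

  adj-of-orientation : ∀ {D} → IsOrientation G D → ∀ {u v} →
                       T (D u v) ⊎ T (D v u) → T (adj G u v)
  adj-of-orientation isO (inj₁ uv) = onEdges isO _ _ uv
  adj-of-orientation isO (inj₂ vu) = adj-sym (onEdges isO _ _ vu)

  Γ-sym : ∀ {p q} → Γ G p q → Γ G q p
  Γ-sym (p∈Z , q∈Z , inj₁ (refl , refl)) = q∈Z , p∈Z , inj₁ (refl , refl)
  Γ-sym (p∈Z , q∈Z , inj₂ (inj₁ (refl , v≢x , v≁x))) =
    q∈Z , p∈Z , inj₂ (inj₂ (refl , ≢-sym v≢x , v≁x ∘ adj-sym))
  Γ-sym (p∈Z , q∈Z , inj₂ (inj₂ (refl , u≢y , u≁y))) =
    q∈Z , p∈Z , inj₂ (inj₁ (refl , ≢-sym u≢y , u≁y ∘ adj-sym))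

  Γ-swap : ∀ {p q} → Γ G p q → Γ G (swap p) (swap q)
  Γ-swap (p∈Z , q∈Z , inj₁ (refl , refl)) =
    adj-sym p∈Z , adj-sym q∈Z , inj₁ (refl , refl)
  Γ-swap (p∈Z , q∈Z , inj₂ (inj₁ second)) =
    adj-sym p∈Z , adj-sym q∈Z , inj₂ (inj₂ second)
  Γ-swap (p∈Z , q∈Z , inj₂ (inj₂ third)) =
    adj-sym p∈Z , adj-sym q∈Z , inj₂ (inj₁ third)

  Γ? : Decidable (Γ G)
  Γ? (u , v) (x , y) =
    T? (adj G u v) ×-dec T? (adj G x y) ×-dec
      ((u ≟ x ×-dec v ≟ y) ⊎-dec
       (u ≟ y ×-dec ¬? (v ≟ x) ×-dec ¬? (T? (adj G v x))) ⊎-dec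
       (v ≟ x ×-dec ¬? (u ≟ y) ×-dec ¬? (T? (adj G u y))))

  Γ*-sym : ∀ {p q} → Γ* G p q → Γ* G q p
  Γ*-sym = symmetric (Γ G) Γ-sym

  Γ*-swap : ∀ {p q} → Γ* G p q → Γ* G (swap p) (swap q)
  Γ*-swap [ γ ]    = [ Γ-swap γ ]
  Γ*-swap (γ ∷ γs) = Γ-swap γ ∷ Γ*-swap γs

  Γ*-target∈Z : ∀ {p q} → Γ* G p q → InZ G q
  Γ*-target∈Z [ (_ , q∈Z , _) ] = q∈Z
  Γ*-target∈Z (_ ∷ γs)          = Γ*-target∈Z γs

  Γ*? : Decidable (Γ* G)
  Γ*? = transClosure? Γ? (cartesianProduct (allFin n) (allFin n))
          λ (u , v) → ∈-cartesianProduct⁺ (∈-allFin u) (∈-allFin v)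

  Γ-Closed : (Fin n × Fin n → Set) → Set
  Γ-Closed P = ∀ {p q} → Γ G p q → P p → P q

  Γ*-closed : ∀ {P} → Γ-Closed P → ∀ {p q} → Γ* G p q → P p → P q
  Γ*-closed closed [ γ ]    = closed γ
  Γ*-closed closed (γ ∷ γs) = λ Pp → Γ*-closed closed γs (closed γ Pp)

Arcs : ∀ {n} → (Fin n → Fin n → Bool) → Fin n × Fin n → Set
Arcs D (u , v) = T (D u v)

-- The non-trivial Γ-steps (u,v) Γ (x,u) and (u,v) Γ (v,y) relate two edges
-- at a common tail, resp. head, whose other ends are non-adjacent.
module _ {n : ℕ} {G : Graph n} {D : Fin n → Fin n → Bool} (isO : IsOrientation G D) where

  localTournament⇒Γ-closed : IsLocalTournament D → Γ-Closed G (Arcs D)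
  localTournament⇒Γ-closed _ (_ , _ , inj₁ (refl , refl)) uv = uv
  localTournament⇒Γ-closed (out , _)
    {u , v} {x , _} (_ , x∼u , inj₂ (inj₁ (refl , v≢x , v≁x))) uv
    with total isO x u x∼u
  ... | inj₁ xu = xu
  ... | inj₂ ux = ⊥-elim (v≁x (adj-of-orientation G isO (out u v x uv ux v≢x)))
  localTournament⇒Γ-closed (_ , in′)
    {u , v} {_ , y} (_ , v∼y , inj₂ (inj₂ (refl , u≢y , u≁y))) uv
    with total isO v y v∼y
  ... | inj₁ vy = vy
  ... | inj₂ yv = ⊥-elim (u≁y (adj-of-orientation G isO (in′ v u y uv yv u≢y)))

  Γ-closed⇒localTournament : Γ-Closed G (Arcs D) → IsLocalTournament D
  Γ-closed⇒localTournament closed = out , in′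
    where
    out : ∀ x y z → T (D x y) → T (D x z) → y ≢ z → T (D y z) ⊎ T (D z y)
    out x y z xy xz y≢z with T? (adj G y z)
    ... | yes y∼z = total isO y z y∼z
    ... | no y≁z  = ⊥-elim (anti isO x z xz
                      (closed (onEdges isO x y xy , adj-sym G (onEdges isO x z xz) ,
                               inj₂ (inj₁ (refl , y≢z , y≁z))) xy))
    in′ : ∀ x y z → T (D y x) → T (D z x) → y ≢ z → T (D y z) ⊎ T (D z y)
    in′ x y z yx zx y≢z with T? (adj G y z)
    ... | yes y∼z = total isO y z y∼z
    ... | no y≁z  = ⊥-elim (anti isO z x zx
                      (closed (onEdges isO y x yx , adj-sym G (onEdges isO z x zx) ,
                               inj₂ (inj₂ (refl , y≢z , y≁z))) yx))

completable⇒noOpposingArcs : ∀ {n} (H : POGraph n) → CompletableToLT H → ¬ HasOpposingArcs H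
completable⇒noOpposingArcs H (D , isO , isLT , arcs⊆D) (a , b , c , d , ab , cd , γs) =
  anti isO c d (arcs⊆D c d cd)
    (Γ*-closed (U H) (localTournament⇒Γ-closed isO isLT) γs (arcs⊆D a b ab))

override : ∀ {n} {F : Fin n × Fin n → Set} → (∀ p → Dec (F p)) →
           (Fin n → Fin n → Bool) → Fin n → Fin n → Bool
override F? D u v with F? (u , v) | F? (v , u)
... | yes _ | _     = true
... | no _  | yes _ = false
... | no _  | no _  = D u v

module _ {n : ℕ} {F : Fin n × Fin n → Set} (F? : ∀ p → Dec (F p))
         {D : Fin n → Fin n → Bool} where

  override-extends : ∀ {u v} → F (u , v) → T (override F? D u v)
  override-extends {u} {v} f with F? (u , v)
  ... | yes _  = tt
  ... | no ¬f = ⊥-elim (¬f f)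

  override-cases : ∀ {u v} → T (override F? D u v) → F (u , v) ⊎ (¬ F (v , u) × T (D u v))
  override-cases {u} {v} uv with F? (u , v) | F? (v , u)
  ... | yes f | _      = inj₁ f
  ... | no _  | no ¬f′ = inj₂ (¬f′ , uv)

  override-orientation : ∀ {G} → (∀ {u v} → F (u , v) → T (adj G u v)) →
                         (∀ {u v} → F (u , v) → ¬ F (v , u)) →
                         IsOrientation G D → IsOrientation G (override F? D)
  override-orientation {G} F⇒adj F-anti isO = record
    { onEdges = λ u v uv → ⊎.[ F⇒adj , (λ (_ , uv) → onEdges isO u v uv) ] (override-cases uv)
    ; total   = total′
    ; anti    = anti′
    }
    where
    total′ : ∀ u v → T (adj G u v) → T (override F? D u v) ⊎ T (override F? D v u)
    total′ u v u∼v with F? (u , v) | F? (v , u)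
    ... | yes _ | _     = inj₁ tt
    ... | no _  | yes _ = inj₂ tt
    ... | no _  | no _  = total isO u v u∼v
    anti′ : ∀ u v → T (override F? D u v) → ¬ T (override F? D v u)
    anti′ u v uv vu with F? (u , v) | F? (v , u)
    ... | yes f | yes f′ = F-anti f f′
    ... | no _  | no _   = anti isO u v uv vu

  override-Γ-closed : ∀ {G} → Γ-Closed G F → Γ-Closed G (Arcs D) →
                      Γ-Closed G (Arcs (override F? D))
  override-Γ-closed {G} F-closed D-closed {u , v} {x , y} γ uv with override-cases uv
  ... | inj₁ f = override-extends (F-closed γ f)
  ... | inj₂ (¬f′ , uv) with F? (x , y) | F? (y , x)
  ...   | yes _ | _     = tt
  ...   | no _  | yes g = ⊥-elim (¬f′ (F-closed (Γ-swap G (Γ-sym G γ)) g))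
  ...   | no _  | no _  = D-closed γ uv

module _ {n : ℕ} (H : POGraph n) where

  Forced : Fin n × Fin n → Set
  Forced p = ∃ λ a → ∃ λ b → T (arc H a b) × Γ* (U H) (a , b) p

  forced? : ∀ p → Dec (Forced p)
  forced? p = any? λ a → any? λ b → T? (arc H a b) ×-dec Γ*? (U H) (a , b) p

  arc⇒forced : ∀ {u v} → T (arc H u v) → Forced (u , v)
  arc⇒forced {u} {v} uv = u , v , uv , [ u∼v , u∼v , inj₁ (refl , refl) ]
    where
    u∼v : T (adj (U H) u v)
    u∼v = arc⊆ H u v uv

  forced⇒adj : ∀ {u v} → Forced (u , v) → T (adj (U H) u v)
  forced⇒adj (_ , _ , _ , γs) = Γ*-target∈Z (U H) γs

  forced-Γ-closed : Γ-Closed (U H) Forced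
  forced-Γ-closed γ (a , b , ab , γs) = a , b , ab , γs ∷ʳ γ

  noOpposingArcs⇒forced-anti : ¬ HasOpposingArcs H →
                               ∀ {u v} → Forced (u , v) → ¬ Forced (v , u)
  noOpposingArcs⇒forced-anti noOpp (a , b , ab , γs) (c , d , cd , δs) =
    noOpp (a , b , c , d , ab , cd , γs ++ Γ*-sym (U H) (Γ*-swap (U H) δs))

  noOpposingArcs⇒completable : LTOrientable (U H) → ¬ HasOpposingArcs H → CompletableToLT H
  noOpposingArcs⇒completable (D , isO , isLT) noOpp =
    override forced? D , isO′ ,
    Γ-closed⇒localTournament isO′
      (override-Γ-closed forced? {G = U H} forced-Γ-closed (localTournament⇒Γ-closed isO isLT)) ,
    λ u v uv → override-extends forced? (arc⇒forced uv)
    where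
    isO′ : IsOrientation (U H) (override forced? D)
    isO′ = override-orientation forced? forced⇒adj (noOpposingArcs⇒forced-anti noOpp) isO

proposition2p6 : ∀ (n : ℕ) (H : POGraph n) → LTOrientable (U H) →
                   (CompletableToLT H ⇔ (¬ HasOpposingArcs H))
proposition2p6 n H orientable =
  mk⇔ (completable⇒noOpposingArcs H) (noOpposingArcs⇒completable H orientable)
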